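{- For every positive integer $n$ and every integer $k$ with $1\le k\le\lfloor n/2\rfloor$, there exists a permutation $\pi\in S_n$ such that $G_\pi$ is connected and has domination number $k$.
   Context: For a permutation $\pi$ of $[n]=\{1,\dots,n\}$ (one-line notation $[\pi(1),\dots,\pi(n)]$), the permutation graph $G_\pi$ has vertex set $[n]$ and an edge between $i<j$ iff $\pi^{ -1}(i)>\pi^{ -1}(j)$. The domination number is the minimum size of a set $D$ of vertices such that every vertex is in $D$ or adjacent to a vertex of $D$. -}

module Defs where

open import Data.Nat using (ℕ; _≤_)
open import Data.Fin using (Fin; _<_; _>_)
open import Data.Fin.Permutation using (Permutation′; _⟨$⟩ˡ_)
open import Data.Fin.Subset using (Subset; _∈_; ∣_∣)
open import Data.Product using (Σ; ∃; _×_; _,_)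
open import Data.Sum using (_⊎_)
open import Relation.Binary.PropositionalEquality using (_≡_)
open import Relation.Binary.Construct.Closure.ReflexiveTransitive using (Star)

-- Vertices of G_π are the elements of Fin n (representing [n] = {1..n}).
-- For i < j, {i,j} is an edge iff π⁻¹(i) > π⁻¹(j).
-- Here π ⟨$⟩ˡ i is the inverse permutation applied to i.
OrderedEdge : ∀ {n} → Permutation′ n → Fin n → Fin n → Set
OrderedEdge π i j = (i < j) × ((π ⟨$⟩ˡ i) > (π ⟨$⟩ˡ j))

Adj : ∀ {n} → Permutation′ n → Fin n → Fin n → Set
Adj π u v = OrderedEdge π u v ⊎ OrderedEdge π v u

Connected : ∀ {n} → Permutation′ n → Set
Connected π = ∀ u v → Star (Adj π) u v

Dominating : ∀ {n} → Permutation′ n → Subset n → Set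
Dominating π D = ∀ v → v ∈ D ⊎ (∃ λ u → u ∈ D × Adj π u v)

DominationNumber : ∀ {n} → Permutation′ n → ℕ → Set
DominationNumber {n} π k =
  (Σ (Subset n) λ D → Dominating π D × ∣ D ∣ ≡ k)
  × (∀ (D : Subset n) → Dominating π D → k ≤ ∣ D ∣)

module Submission where

-- A permutation π is handled through its position map σ = π⁻¹ (vertex ↦ position),
-- so that vertices u < v are adjacent in G_π iff σ u > σ v.
--
-- The proof constructs "certificates": a connected G_π together with a dominating set D
-- of size k that contains the root (the vertex in position 0), such that every set
-- dominating all vertices except the root has at least k elements; in particular the
-- domination number of G_π is k.  Certificates are grown by two operations that insert
-- new vertices carrying the smallest labels while shifting the old labels and positions
-- monotonically, so that the old graph survives as an induced subgraph:
--   * Pendant: one new vertex, adjacent to the root only (n ↦ n+1, k unchanged);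
--   * Block:   a path 0–2–1–3 whose vertex 1 is attached to the old root, with the new
--              root 2 (n ↦ n+4, k ↦ k+2).
-- In both cases edges between new and old vertices only touch the old root, so a set
-- dominating the new graph except its root restricts to one dominating the old graph
-- except its root ("restriction lemma"); the new vertices force the extra elements.
-- Starting from K₂ (k = 1) and P₄ (k = 2), blocks reach 2k vertices and pendants then
-- fill up to n vertices, which is possible exactly when k ≤ n/2.

open import Defs
open import Data.Nat using (ℕ; zero; suc; _+_; _*_; _∸_; _≤_; _/_; z≤n; s≤s)
import Data.Nat as Nat
import Data.Nat.Properties as NP
open import Data.Nat.DivMod using (m/n*n≤m)
open import Data.Fin using (Fin; zero; suc; toℕ; _<_; _↑ʳ_; _↑ˡ_)
open import Data.Fin.Patterns using (0F; 1F; 2F; 3F; 4F)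
import Data.Fin.Properties as FP
open import Data.Fin.Permutation using (Permutation′; permutation; _⟨$⟩ʳ_; _⟨$⟩ˡ_; inverseˡ; inverseʳ)
open import Data.Fin.Subset using (Subset; _∈_; ∣_∣; inside; outside)
open import Data.Fin.Subset.Properties using (∣p∣≤∣x∷p∣)
open import Data.Vec.Base using ([]; _∷_; _++_; here; there)
open import Data.Product using (∃; _×_; _,_)
open import Data.Sum using (_⊎_; inj₁; inj₂; swap)
import Data.Sum as Sum
open import Data.Empty using (⊥-elim)
open import Function using (_∘_)
open import Relation.Binary.Core using (_Preserves_⟶_)
open import Relation.Binary.Definitions using (tri<; tri≈; tri>)
open import Relation.Binary.PropositionalEquality
  using (_≡_; _≢_; refl; sym; trans; cong; subst; subst₂; module ≡-Reasoning)
open import Relation.Binary.Construct.Closure.ReflexiveTransitive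
  using (Star; ε; _◅_; _◅◅_; gmap; reverse)

<-reflect : ∀ {m n} {f : Fin m → Fin n} → f Preserves _<_ ⟶ _<_ →
            ∀ {x y} → f x < f y → x < y
<-reflect mono {x} {y} fx<fy with FP.<-cmp x y
... | tri< x<y _ _ = x<y
... | tri≈ _ refl _ = ⊥-elim (FP.<-irrefl refl fx<fy)
... | tri> _ _ y<x = ⊥-elim (FP.<-asym fx<fy (mono y<x))

<1⇒zero : ∀ {n} {p : Fin (suc n)} → toℕ p Nat.< 1 → p ≡ zero
<1⇒zero {p = zero}  _ = refl
<1⇒zero {p = suc p} (s≤s ())

↑ʳ-mono : ∀ h {n} → (_↑ʳ_ {n} h) Preserves _<_ ⟶ _<_
↑ʳ-mono zero    x<y = x<y
↑ʳ-mono (suc h) x<y = s≤s (↑ʳ-mono h x<y)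

∈⇒1≤∣p∣ : ∀ {n} {u : Fin n} {p : Subset n} → u ∈ p → 1 ≤ ∣ p ∣
∈⇒1≤∣p∣ here = s≤s z≤n
∈⇒1≤∣p∣ {p = x ∷ p} (there u∈p) = NP.≤-trans (∈⇒1≤∣p∣ u∈p) (∣p∣≤∣x∷p∣ x p)

two-members : ∀ {n} {u v : Fin n} {p : Subset n} → u ∈ p → v ∈ p → u ≢ v → 2 ≤ ∣ p ∣
two-members here        here        u≢v = ⊥-elim (u≢v refl)
two-members here        (there v∈p) _   = s≤s (∈⇒1≤∣p∣ v∈p)
two-members (there u∈p) here        _   = s≤s (∈⇒1≤∣p∣ u∈p)
two-members {p = x ∷ p} (there u∈p) (there v∈p) u≢v =
  NP.≤-trans (two-members u∈p v∈p (u≢v ∘ cong suc)) (∣p∣≤∣x∷p∣ x p)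

∈-↑ˡ⁻ : ∀ {h n} (xs : Subset h) {E : Subset n} {i : Fin h} → (i ↑ˡ n) ∈ (xs ++ E) → i ∈ xs
∈-↑ˡ⁻ (_ ∷ xs) {i = zero}  here        = here
∈-↑ˡ⁻ (_ ∷ xs) {i = suc i} (there i∈p) = there (∈-↑ˡ⁻ xs i∈p)

∈-↑ʳ⁺ : ∀ {h n} (xs : Subset h) {E : Subset n} {v : Fin n} → v ∈ E → (h ↑ʳ v) ∈ (xs ++ E)
∈-↑ʳ⁺ []       v∈E = v∈E
∈-↑ʳ⁺ (_ ∷ xs) v∈E = there (∈-↑ʳ⁺ xs v∈E)

∈-↑ʳ⁻ : ∀ {h n} (xs : Subset h) {E : Subset n} {v : Fin n} → (h ↑ʳ v) ∈ (xs ++ E) → v ∈ E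
∈-↑ʳ⁻ []       v∈p         = v∈p
∈-↑ʳ⁻ (_ ∷ xs) (there v∈p) = ∈-↑ʳ⁻ xs v∈p

∣++∣ : ∀ {h n} (xs : Subset h) (E : Subset n) → ∣ xs ++ E ∣ ≡ ∣ xs ∣ + ∣ E ∣
∣++∣ []            E = refl
∣++∣ (inside  ∷ xs) E = cong suc (∣++∣ xs E)
∣++∣ (outside ∷ xs) E = ∣++∣ xs E

++-size-≥ : ∀ {h n j k} (xs : Subset h) (E : Subset n) →
            j ≤ ∣ xs ∣ → k ≤ ∣ E ∣ → j + k ≤ ∣ xs ++ E ∣
++-size-≥ xs E j≤ k≤ = subst (_ ≤_) (sym (∣++∣ xs E)) (NP.+-mono-≤ j≤ k≤)

root : ∀ {m} → Permutation′ (suc m) → Fin (suc m)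
root π = π ⟨$⟩ʳ zero

at-root : ∀ {m} (π : Permutation′ (suc m)) {v} → π ⟨$⟩ˡ v ≡ zero → v ≡ root π
at-root π eq = trans (sym (inverseʳ π)) (cong (π ⟨$⟩ʳ_) eq)

position-injective : ∀ {n} (π : Permutation′ n) {u v} → π ⟨$⟩ˡ u ≡ π ⟨$⟩ˡ v → u ≡ v
position-injective π eq = trans (sym (inverseʳ π)) (trans (cong (π ⟨$⟩ʳ_) eq) (inverseʳ π))

hub-connected : ∀ {n} (π : Permutation′ n) (r : Fin n) → (∀ v → Star (Adj π) v r) → Connected π
hub-connected π r to-hub u v = to-hub u ◅◅ reverse swap (to-hub v)

DominatesExcept : ∀ {n} → Permutation′ n → Fin n → Subset n → Set
DominatesExcept π r E = ∀ v → v ≢ r → v ∈ E ⊎ ∃ λ u → u ∈ E × Adj π u v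

-- The old graph inside an extension.  π' lives on h new vertices (labels below h)
-- followed by the old ones; old labels are shifted by h and old positions are moved
-- by a strictly monotone map g.  Then G_π is an induced subgraph of G_π'.
module OldPart (h : ℕ) {n} (π : Permutation′ n) (π' : Permutation′ (h + n))
  (g : Fin n → Fin (h + n)) (g-mono : g Preserves _<_ ⟶ _<_)
  (commute : ∀ v → π' ⟨$⟩ˡ (h ↑ʳ v) ≡ g (π ⟨$⟩ˡ v)) where

  edge⁺ : ∀ {u v} → OrderedEdge π u v → OrderedEdge π' (h ↑ʳ u) (h ↑ʳ v)
  edge⁺ {u} {v} (u<v , σv<σu) =
    ↑ʳ-mono h u<v , subst₂ _<_ (sym (commute v)) (sym (commute u)) (g-mono σv<σu)

  edge⁻ : ∀ {u v} → OrderedEdge π' (h ↑ʳ u) (h ↑ʳ v) → OrderedEdge π u v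
  edge⁻ {u} {v} (u<v , σv<σu) =
    <-reflect (↑ʳ-mono h) u<v , <-reflect g-mono (subst₂ _<_ (commute v) (commute u) σv<σu)

  adj⁺ : ∀ {u v} → Adj π u v → Adj π' (h ↑ʳ u) (h ↑ʳ v)
  adj⁺ = Sum.map edge⁺ edge⁺

  adj⁻ : ∀ {u v} → Adj π' (h ↑ʳ u) (h ↑ʳ v) → Adj π u v
  adj⁻ = Sum.map edge⁻ edge⁻

  walk⁺ : ∀ {u v} → Star (Adj π) u v → Star (Adj π') (h ↑ʳ u) (h ↑ʳ v)
  walk⁺ = gmap (h ↑ʳ_) adj⁺

  dominated⁺ : ∀ {D} (xs : Subset h) → Dominating π D →
               ∀ v → (h ↑ʳ v) ∈ (xs ++ D) ⊎ ∃ λ u → u ∈ (xs ++ D) × Adj π' u (h ↑ʳ v)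
  dominated⁺ xs D-dom v with D-dom v
  ... | inj₁ v∈D             = inj₁ (∈-↑ʳ⁺ xs v∈D)
  ... | inj₂ (u , u∈D , u~v) = inj₂ (h ↑ʳ u , ∈-↑ʳ⁺ xs u∈D , adj⁺ u~v)

  restrict : ∀ {r r'} (xs : Subset h) (E : Subset n) →
             (∀ {w v} → Adj π' w (h ↑ʳ v) → v ≢ r → ∃ λ u → w ≡ h ↑ʳ u) →
             (∀ {v} → v ≢ r → h ↑ʳ v ≢ r') →
             DominatesExcept π' r' (xs ++ E) → DominatesExcept π r E
  restrict xs E only-root avoid H v v≢r with H (h ↑ʳ v) (avoid v≢r)
  ... | inj₁ v∈E = inj₁ (∈-↑ʳ⁻ xs v∈E)
  ... | inj₂ (w , w∈E , w~v) with only-root w~v v≢r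
  ...   | u , refl = inj₂ (u , ∈-↑ʳ⁻ xs w∈E , adj⁻ w~v)

record Certificate (m k : ℕ) : Set where
  field
    π          : Permutation′ (suc m)
    connected  : Connected π
    D          : Subset (suc m)
    dominating : Dominating π D
    size       : ∣ D ∣ ≡ k
    root∈D     : root π ∈ D
    tight      : ∀ E → DominatesExcept π (root π) E → k ≤ ∣ E ∣

realise : ∀ {m k} → Certificate m k →
          ∃ λ (π : Permutation′ (suc m)) → Connected π × DominationNumber π k
realise C = π , connected , (D , dominating , size) , λ E E-dom → tight E (λ v _ → E-dom v)
  where open Certificate C

skip₁ : ∀ {n} → Fin n → Fin (suc n)
skip₁ zero    = zero
skip₁ (suc p) = suc (suc p)

skip₁-mono : ∀ {n} → skip₁ {n} Preserves _<_ ⟶ _<_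
skip₁-mono {x = zero}  {suc y} _         = s≤s z≤n
skip₁-mono {x = suc x} {suc y} (s≤s x<y) = s≤s (s≤s x<y)

skip₁-below-1 : ∀ {n} {p : Fin (suc n)} → toℕ (skip₁ p) Nat.< 1 → p ≡ zero
skip₁-below-1 {p = zero}  _             = refl
skip₁-below-1 {p = suc p} (s≤s ())

-- Pendant step: a new vertex 0 in position 1, adjacent exactly to the root.
module Pendant {m k} (C : Certificate m k) where
  open Certificate C

  σ' : Fin (2 + m) → Fin (2 + m)
  σ' zero    = 1F
  σ' (suc v) = skip₁ (π ⟨$⟩ˡ v)

  τ' : Fin (2 + m) → Fin (2 + m)
  τ' zero          = suc (root π)
  τ' (suc zero)    = zero
  τ' (suc (suc p)) = suc (π ⟨$⟩ʳ suc p)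

  τ'-skip₁ : ∀ p → τ' (skip₁ p) ≡ suc (π ⟨$⟩ʳ p)
  τ'-skip₁ zero    = refl
  τ'-skip₁ (suc p) = refl

  τ'σ' : ∀ v → τ' (σ' v) ≡ v
  τ'σ' zero    = refl
  τ'σ' (suc v) = trans (τ'-skip₁ (π ⟨$⟩ˡ v)) (cong suc (inverseʳ π))

  σ'τ' : ∀ p → σ' (τ' p) ≡ p
  σ'τ' zero          = cong skip₁ (inverseˡ π)
  σ'τ' (suc zero)    = refl
  σ'τ' (suc (suc p)) = cong skip₁ (inverseˡ π)

  π' : Permutation′ (2 + m)
  π' = permutation τ' σ' τ'σ' σ'τ'

  open OldPart 1 π π' skip₁ skip₁-mono (λ _ → refl)

  leaf-edge : Adj π' zero (root π')
  leaf-edge = inj₁ (s≤s z≤n , subst (λ p → toℕ (skip₁ p) Nat.< 1) (sym (inverseˡ π)) (s≤s z≤n))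

  only-root : ∀ {w v} → Adj π' w (suc v) → v ≢ root π → ∃ λ u → w ≡ suc u
  only-root {suc u} _                   _   = u , refl
  only-root {zero}  (inj₁ (_ , σv<σ0)) v≢r = ⊥-elim (v≢r (at-root π (skip₁-below-1 σv<σ0)))
  only-root {zero}  (inj₂ (() , _))

  to-root : ∀ v → Star (Adj π') v (root π')
  to-root zero    = leaf-edge ◅ ε
  to-root (suc v) = walk⁺ (connected v (root π))

  dominating' : Dominating π' (outside ∷ D)
  dominating' zero    = inj₂ (root π' , there root∈D , swap leaf-edge)
  dominating' (suc v) = dominated⁺ (outside ∷ []) dominating v

  tight' : ∀ E → DominatesExcept π' (root π') E → k ≤ ∣ E ∣
  tight' (x ∷ E) H = ++-size-≥ (x ∷ []) E z≤n (tight E (restrict (x ∷ []) E only-root avoid H))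
    where
    avoid : ∀ {v} → v ≢ root π → suc v ≢ root π'
    avoid v≢r = v≢r ∘ FP.suc-injective

  certificate : Certificate (suc m) k
  certificate = record
    { π = π' ; connected = hub-connected π' (root π') to-root
    ; D = outside ∷ D ; dominating = dominating' ; size = size
    ; root∈D = there root∈D ; tight = tight' }

withPendants : ∀ {m k} e → Certificate m k → Certificate (e + m) k
withPendants zero    C = C
withPendants (suc e) C = Pendant.certificate (withPendants e C)

-- In any G_π where vertices 0, 2, 3 sit in positions 1, 0, 2 and all vertices beyond 3
-- sit after position 2, the leaf 0 has the single neighbour 2 and the leaf 3
-- has the single neighbour 1.  Hence a set dominating all but 2 meets {0,2} and {1,3}.
module Leaves {n} (π : Permutation′ (4 + n))
  (pos0 : π ⟨$⟩ˡ 0F ≡ 1F) (pos2 : π ⟨$⟩ˡ 2F ≡ 0F) (pos3 : π ⟨$⟩ˡ 3F ≡ 2F)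
  (late : ∀ v → 2 Nat.< toℕ (π ⟨$⟩ˡ (4 ↑ʳ v))) where

  only-2F-sees-0F : ∀ w → Adj π w 0F → w ≡ 2F
  only-2F-sees-0F w (inj₁ (() , _))
  only-2F-sees-0F w (inj₂ (_ , σw<σ0)) =
    position-injective π (trans (<1⇒zero (subst (π ⟨$⟩ˡ w <_) pos0 σw<σ0)) (sym pos2))

  only-1F-sees-3F : ∀ w → Adj π w 3F → w ≡ 1F
  only-1F-sees-3F 1F _ = refl
  only-1F-sees-3F 0F (inj₁ (_ , σ3<σ0)) = ⊥-elim (NP.<⇒≱ (subst₂ _<_ pos3 pos0 σ3<σ0) (s≤s z≤n))
  only-1F-sees-3F 2F (inj₁ (_ , σ3<σ2)) = ⊥-elim (NP.<⇒≱ (subst₂ _<_ pos3 pos2 σ3<σ2) z≤n)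
  only-1F-sees-3F 3F (inj₁ (3<3 , _))   = ⊥-elim (NP.<-irrefl refl 3<3)
  only-1F-sees-3F (suc (suc (suc (suc v)))) (inj₁ (s≤s (s≤s (s≤s ())) , _))
  only-1F-sees-3F 0F (inj₂ (() , _))
  only-1F-sees-3F 2F (inj₂ (s≤s (s≤s ()) , _))
  only-1F-sees-3F 3F (inj₂ (s≤s (s≤s (s≤s ())) , _))
  only-1F-sees-3F (suc (suc (suc (suc v)))) (inj₂ (_ , σv<σ3)) =
    ⊥-elim (NP.<-asym (subst (π ⟨$⟩ˡ (4 ↑ʳ v) <_) pos3 σv<σ3) (late v))

  leaf₀ : ∀ {E} → DominatesExcept π 2F E → 0F ∈ E ⊎ 2F ∈ E
  leaf₀ {E} H with H 0F (λ ())
  ... | inj₁ 0∈E             = inj₁ 0∈E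
  ... | inj₂ (w , w∈E , w~0) = inj₂ (subst (_∈ E) (only-2F-sees-0F w w~0) w∈E)

  leaf₃ : ∀ {E} → DominatesExcept π 2F E → 1F ∈ E ⊎ 3F ∈ E
  leaf₃ {E} H with H 3F (λ ())
  ... | inj₁ 3∈E             = inj₂ 3∈E
  ... | inj₂ (w , w∈E , w~3) = inj₁ (subst (_∈ E) (only-1F-sees-3F w w~3) w∈E)

meets-both-pairs : ∀ {n} {p : Subset (4 + n)} → 0F ∈ p ⊎ 2F ∈ p → 1F ∈ p ⊎ 3F ∈ p → 2 ≤ ∣ p ∣
meets-both-pairs (inj₁ a) (inj₁ b) = two-members a b (λ ())
meets-both-pairs (inj₁ a) (inj₂ b) = two-members a b (λ ())
meets-both-pairs (inj₂ a) (inj₁ b) = two-members a b (λ ())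
meets-both-pairs (inj₂ a) (inj₂ b) = two-members a b (λ ())

K₂ : Certificate 1 1
K₂ = record
  { π = π ; connected = hub-connected π 1F to-root
  ; D = outside ∷ inside ∷ [] ; dominating = dominating ; size = refl
  ; root∈D = there here ; tight = tight }
  where
  σ : Fin 2 → Fin 2
  σ 0F = 1F
  σ 1F = 0F
  σσ : ∀ v → σ (σ v) ≡ v
  σσ 0F = refl
  σσ 1F = refl
  π : Permutation′ 2
  π = permutation σ σ σσ σσ
  edge : Adj π 0F 1F
  edge = inj₁ (s≤s z≤n , s≤s z≤n)
  to-root : ∀ v → Star (Adj π) v 1F
  to-root 0F = edge ◅ ε
  to-root 1F = ε
  dominating : Dominating π (outside ∷ inside ∷ [])
  dominating 0F = inj₂ (1F , there here , swap edge)
  dominating 1F = inj₁ (there here)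
  tight : ∀ E → DominatesExcept π 1F E → 1 ≤ ∣ E ∣
  tight E H with H 0F (λ ())
  ... | inj₁ 0∈E           = ∈⇒1≤∣p∣ 0∈E
  ... | inj₂ (_ , u∈E , _) = ∈⇒1≤∣p∣ u∈E

-- P₄ = 0–2–1–3: positions [1,3,0,2], root 2, minimum dominating set {1,2}.
P₄ : Certificate 3 2
P₄ = record
  { π = π ; connected = hub-connected π 1F to-hub
  ; D = outside ∷ inside ∷ inside ∷ outside ∷ [] ; dominating = dominating ; size = refl
  ; root∈D = there (there here) ; tight = tight }
  where
  σ τ : Fin 4 → Fin 4
  σ 0F = 1F
  σ 1F = 3F
  σ 2F = 0F
  σ 3F = 2F
  τ 0F = 2F
  τ 1F = 0F
  τ 2F = 3F
  τ 3F = 1F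
  τσ : ∀ v → τ (σ v) ≡ v
  τσ 0F = refl
  τσ 1F = refl
  τσ 2F = refl
  τσ 3F = refl
  στ : ∀ p → σ (τ p) ≡ p
  στ 0F = refl
  στ 1F = refl
  στ 2F = refl
  στ 3F = refl
  π : Permutation′ 4
  π = permutation τ σ τσ στ
  e02 : Adj π 0F 2F
  e02 = inj₁ (s≤s z≤n , s≤s z≤n)
  e21 : Adj π 2F 1F
  e21 = inj₂ (s≤s (s≤s z≤n) , s≤s z≤n)
  e31 : Adj π 3F 1F
  e31 = inj₂ (s≤s (s≤s z≤n) , s≤s (s≤s (s≤s z≤n)))
  to-hub : ∀ v → Star (Adj π) v 1F
  to-hub 0F = e02 ◅ e21 ◅ ε
  to-hub 1F = ε
  to-hub 2F = e21 ◅ ε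
  to-hub 3F = e31 ◅ ε
  dominating : Dominating π (outside ∷ inside ∷ inside ∷ outside ∷ [])
  dominating 0F = inj₂ (2F , there (there here) , swap e02)
  dominating 1F = inj₁ (there here)
  dominating 2F = inj₁ (there (there here))
  dominating 3F = inj₂ (1F , there here , swap e31)
  open Leaves π refl refl refl (λ ())
  tight : ∀ E → DominatesExcept π 2F E → 2 ≤ ∣ E ∣
  tight E H = meets-both-pairs (leaf₀ H) (leaf₃ H)

-- Old positions after inserting positions 0, 1, 2 before and 4 after the old position 0.
blockPos : ∀ {n} → Fin n → Fin (4 + n)
blockPos zero    = 3F
blockPos (suc p) = suc (suc (suc (suc (suc p))))

blockPos-mono : ∀ {n} → blockPos {n} Preserves _<_ ⟶ _<_
blockPos-mono {x = zero}  {suc y} _         = s≤s (s≤s (s≤s (s≤s z≤n)))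
blockPos-mono {x = suc x} {suc y} (s≤s x<y) = s≤s (s≤s (s≤s (s≤s (s≤s x<y))))

blockPos-late : ∀ {n} (p : Fin n) → 2 Nat.< toℕ (blockPos p)
blockPos-late zero    = s≤s (s≤s (s≤s z≤n))
blockPos-late (suc p) = s≤s (s≤s (s≤s z≤n))

blockPos-below-4 : ∀ {n} {p : Fin (suc n)} → toℕ (blockPos p) Nat.< 4 → p ≡ zero
blockPos-below-4 {p = zero}  _ = refl
blockPos-below-4 {p = suc p} (s≤s (s≤s (s≤s (s≤s ()))))

module Block {m k} (C : Certificate m k) where
  open Certificate C

  σ' : Fin (4 + suc m) → Fin (4 + suc m)
  σ' 0F = 1F
  σ' 1F = 4F
  σ' 2F = 0F
  σ' 3F = 2F
  σ' (suc (suc (suc (suc v)))) = blockPos (π ⟨$⟩ˡ v)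

  τ' : Fin (4 + suc m) → Fin (4 + suc m)
  τ' 0F = 2F
  τ' 1F = 0F
  τ' 2F = 3F
  τ' 3F = 4 ↑ʳ root π
  τ' 4F = 1F
  τ' (suc (suc (suc (suc (suc p))))) = 4 ↑ʳ (π ⟨$⟩ʳ suc p)

  τ'-blockPos : ∀ p → τ' (blockPos p) ≡ 4 ↑ʳ (π ⟨$⟩ʳ p)
  τ'-blockPos zero    = refl
  τ'-blockPos (suc p) = refl

  τ'σ' : ∀ v → τ' (σ' v) ≡ v
  τ'σ' 0F = refl
  τ'σ' 1F = refl
  τ'σ' 2F = refl
  τ'σ' 3F = refl
  τ'σ' (suc (suc (suc (suc v)))) = trans (τ'-blockPos (π ⟨$⟩ˡ v)) (cong (4 ↑ʳ_) (inverseʳ π))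

  σ'τ' : ∀ p → σ' (τ' p) ≡ p
  σ'τ' 0F = refl
  σ'τ' 1F = refl
  σ'τ' 2F = refl
  σ'τ' 3F = cong blockPos (inverseˡ π)
  σ'τ' 4F = refl
  σ'τ' (suc (suc (suc (suc (suc p))))) = cong blockPos (inverseˡ π)

  π' : Permutation′ (4 + suc m)
  π' = permutation τ' σ' τ'σ' σ'τ'

  open OldPart 4 π π' blockPos blockPos-mono (λ _ → refl)
  open Leaves π' refl refl refl (λ v → blockPos-late (π ⟨$⟩ˡ v))

  e02 : Adj π' 0F 2F
  e02 = inj₁ (s≤s z≤n , s≤s z≤n)
  e21 : Adj π' 2F 1F
  e21 = inj₂ (s≤s (s≤s z≤n) , s≤s z≤n)
  e31 : Adj π' 3F 1F
  e31 = inj₂ (s≤s (s≤s z≤n) , s≤s (s≤s (s≤s z≤n)))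
  e1r : Adj π' 1F (4 ↑ʳ root π)
  e1r = inj₁ ( s≤s (s≤s z≤n)
             , subst (λ p → toℕ (blockPos p) Nat.< 4) (sym (inverseˡ π)) (s≤s (s≤s (s≤s (s≤s z≤n)))))

  only-root : ∀ {w v} → Adj π' w (4 ↑ʳ v) → v ≢ root π → ∃ λ u → w ≡ 4 ↑ʳ u
  only-root {suc (suc (suc (suc u)))} _ _ = u , refl
  only-root {0F} (inj₁ (_ , σv<1)) _ =
    ⊥-elim (NP.<-asym σv<1 (NP.<-trans (s≤s (s≤s z≤n)) (blockPos-late _)))
  only-root {1F} (inj₁ (_ , σv<4)) v≢r = ⊥-elim (v≢r (at-root π (blockPos-below-4 σv<4)))
  only-root {2F} (inj₁ (_ , ()))
  only-root {3F} (inj₁ (_ , σv<2)) _ = ⊥-elim (NP.<-asym σv<2 (blockPos-late _))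
  only-root {0F} (inj₂ (() , _))
  only-root {1F} (inj₂ (s≤s () , _))
  only-root {2F} (inj₂ (s≤s (s≤s ()) , _))
  only-root {3F} (inj₂ (s≤s (s≤s (s≤s ())) , _))

  to-old-root : ∀ v → Star (Adj π') v (4 ↑ʳ root π)
  to-old-root 0F = e02 ◅ e21 ◅ e1r ◅ ε
  to-old-root 1F = e1r ◅ ε
  to-old-root 2F = e21 ◅ e1r ◅ ε
  to-old-root 3F = e31 ◅ e1r ◅ ε
  to-old-root (suc (suc (suc (suc v)))) = walk⁺ (connected v (root π))

  dominating' : Dominating π' (outside ∷ inside ∷ inside ∷ outside ∷ D)
  dominating' 0F = inj₂ (2F , there (there here) , swap e02)
  dominating' 1F = inj₁ (there here)
  dominating' 2F = inj₁ (there (there here))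
  dominating' 3F = inj₂ (1F , there here , swap e31)
  dominating' (suc (suc (suc (suc v)))) = dominated⁺ (outside ∷ inside ∷ inside ∷ outside ∷ []) dominating v

  tight' : ∀ E → DominatesExcept π' (root π') E → 2 + k ≤ ∣ E ∣
  tight' (x₀ ∷ x₁ ∷ x₂ ∷ x₃ ∷ E) H = ++-size-≥ xs E new-part (tight E (restrict xs E only-root (λ _ ()) H))
    where
    xs = x₀ ∷ x₁ ∷ x₂ ∷ x₃ ∷ []
    new-part : 2 ≤ ∣ xs ∣
    new-part = meets-both-pairs (Sum.map (∈-↑ˡ⁻ xs {i = 0F}) (∈-↑ˡ⁻ xs {i = 2F}) (leaf₀ H))
                                (Sum.map (∈-↑ˡ⁻ xs {i = 1F}) (∈-↑ˡ⁻ xs {i = 3F}) (leaf₃ H))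

  certificate : Certificate (4 + m) (2 + k)
  certificate = record
    { π = π' ; connected = hub-connected π' (4 ↑ʳ root π) to-old-root
    ; D = outside ∷ inside ∷ inside ∷ outside ∷ D ; dominating = dominating'
    ; size = cong (2 +_) size ; root∈D = there (there here) ; tight = tight' }

core : ∀ k → Certificate (suc (k * 2)) (suc k)
core zero          = K₂
core (suc zero)    = P₄
core (suc (suc k)) = Block.certificate (core k)

corollary2 : (n : ℕ) → 1 ≤ n → (k : ℕ) → 1 ≤ k → k ≤ n / 2 →
    ∃ λ (π : Permutation′ n) → Connected π × DominationNumber π k
corollary2 n _ zero    () _
corollary2 n _ (suc k) _  k≤n/2 =
  subst (λ n → ∃ λ (π : Permutation′ n) → Connected π × DominationNumber π (suc k))
        vertices (realise (withPendants e (core k)))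
  where
  open ≡-Reasoning
  e = n ∸ suc k * 2
  room : suc k * 2 ≤ n
  room = NP.≤-trans (NP.*-monoˡ-≤ 2 k≤n/2) (m/n*n≤m n 2)
  vertices : suc (e + suc (k * 2)) ≡ n
  vertices = begin
    suc (e + suc (k * 2)) ≡⟨ sym (NP.+-suc e (suc (k * 2))) ⟩
    e + suc k * 2         ≡⟨ NP.m∸n+n≡m room ⟩
    n                     ∎
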